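{- For every integer $k\geq 1$, the number $18\cdot(1+10^2+10^4+\cdots+10^{2(k-1)})$, whose decimal representation is the string $18$ repeated $k$ times ($18, 1818, 181818,\ldots$), is a $v$-palindrome.
   Context: For an integer $n\geq 1$, $r(n)$ denotes the number formed by writing the decimal digits of $n$ in reverse order. The function $v\colon\mathbb{N}\to\mathbb{Z}$ is the additive arithmetic function (i.e. $v(mn)=v(m)+v(n)$ whenever $\gcd(m,n)=1$, and $v(1)=0$) determined on prime powers by $v(p)=p$ and $v(p^\alpha)=p+\alpha$ for $\alpha\geq 2$. An integer $n\geq 1$ is a $v$-palindrome if $10\nmid n$, $n\neq r(n)$, and $v(n)=v(r(n))$. -}

module Defs where

open import Data.Nat using (ℕ; zero; suc; _+_; _*_; _^_; _≤_; _<_; NonZero)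
open import Data.Nat.DivMod using (_/_; _%_)
open import Data.Nat.Divisibility using (_∣_; _∣?_)
open import Data.Nat.Primality using (Prime; prime?)
open import Data.List using (List; []; _∷_; map; upTo)
open import Data.Nat.ListAction using (sum)
open import Relation.Nullary using (¬_; yes; no)
open import Relation.Nullary.Decidable using (⌊_⌋)
open import Data.Bool using (if_then_else_)
open import Relation.Binary.PropositionalEquality using (_≡_)

-- reversal of decimal digits.  revAux fuel n acc appends digits of n (least
-- significant first) to acc; fuel = n suffices since each step divides by 10.
revAux : ℕ → ℕ → ℕ → ℕ
revAux zero n acc = acc
revAux (suc f) zero acc = acc
revAux (suc f) n@(suc _) acc = revAux f (n / 10) (acc * 10 + n % 10)

r : ℕ → ℕ
r n = revAux n n 0

-- multiplicity of p in n (p ≥ 2, n ≥ 1), computed with fuel n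
multAux : ℕ → (p : ℕ) → .{{NonZero p}} → ℕ → ℕ
multAux zero p n = 0
multAux (suc f) p zero = 0
multAux (suc f) p n@(suc _) with p ∣? n
... | yes _ = suc (multAux f p (n / p))
... | no _ = 0

mult : (p : ℕ) → .{{NonZero p}} → ℕ → ℕ
mult p n = multAux n p n

vpp : ℕ → ℕ → ℕ
vpp p zero = 0
vpp p (suc zero) = p
vpp p α@(suc (suc _)) = p + α

term : ℕ → ℕ → ℕ
term n k with prime? (suc (suc k))
... | yes _ = vpp (suc (suc k)) (mult (suc (suc k)) n)
... | no _ = 0

-- v n = Σ_{p prime, p ≤ n+1} v(p^{ν_p(n)}), the additive function with
-- v(p) = p, v(p^α) = p + α (α ≥ 2); v 1 = 0.
v : ℕ → ℕ
v n = sum (map (term n) (upTo n))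

record VPalindrome (n : ℕ) : Set where
  field
    positive   : 1 ≤ n
    not10∣     : ¬ (10 ∣ n)
    notPalin   : ¬ (n ≡ r n)
    vEq        : v n ≡ v (r n)

rep : ℕ → ℕ
rep zero = 0
rep (suc k) = 1 + 100 * rep k

{-# OPTIONS --safe #-}
module Submission where

-- Reading 18·R, where R = 1 + 10² + ⋯ + 10^{2(k−1)}, from its last digit
-- pair "18" upwards gives 81·R.  As R is odd, 18·R = 2·3²·R and 81·R = 3⁴·R
-- have the same multiplicity at every prime p > 3, so only the primes 2 and 3
-- can make v differ; with a = ν₃(R) their contributions are 2 + (3 + 2 + a)
-- and 0 + (3 + 4 + a), which agree.

open import Defs
open import Data.Nat
open import Data.Nat.Properties
open import Data.Nat.DivMod
open import Data.Nat.Divisibility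
open import Data.Nat.Primality
open import Data.Nat.Induction using (<-wellFounded)
open import Induction.WellFounded using (Acc; acc)
open import Data.List using (applyUpTo)
open import Data.List.Properties using (map-upTo)
open import Data.Nat.ListAction using (sum)
open import Data.Nat.Tactic.RingSolver using (solve-∀)
open import Algebra.Properties.CommutativeSemigroup *-commutativeSemigroup using (xy∙z≈xz∙y)
open import Data.Sum using ([_,_]′)
open import Data.Unit using (tt)
open import Function using (_∘_)
open import Relation.Nullary using (¬_; yes; no; contradiction)
open import Relation.Nullary.Decidable using (toWitness)
open import Relation.Binary.PropositionalEquality
open ≡-Reasoning

prime[3] : Prime 3
prime[3] = toWitness {a? = prime? 3} tt

¬∣-remainder : ∀ {d} .{{_ : NonZero d}} r q → 0 < r → r < d → ¬ d ∣ r + q * d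
¬∣-remainder {d} r q 0<r r<d d∣ = >⇒≢ 0<r (begin
  r                   ≡⟨ m<n⇒m%n≡m r<d ⟨
  r % d               ≡⟨ [m+kn]%n≡m%n r q d ⟨
  (r + q * d) % d     ≡⟨ n∣m⇒m%n≡0 _ d d∣ ⟩
  0                   ∎)

multAux-fuel : ∀ p .{{_ : NonZero p}} → 1 < p → ∀ f g n → n ≤ f → n ≤ g →
               multAux f p n ≡ multAux g p n
multAux-fuel p 1<p zero    zero    zero    _         _         = refl
multAux-fuel p 1<p zero    (suc g) zero    _         _         = refl
multAux-fuel p 1<p (suc f) zero    zero    _         _         = refl
multAux-fuel p 1<p (suc f) (suc g) zero    _         _         = refl
multAux-fuel p 1<p (suc f) (suc g) (suc n) (s≤s n≤f) (s≤s n≤g) with p ∣? suc n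
... | yes _ = cong suc (multAux-fuel p 1<p f g (suc n / p) (≤-trans n/p≤n n≤f) (≤-trans n/p≤n n≤g))
  where n/p≤n : suc n / p ≤ n
        n/p≤n = s≤s⁻¹ (m/n<m (suc n) p 1<p)
... | no _  = refl

mult-∣ : ∀ p .{{_ : NonZero p}} → 1 < p → ∀ n .{{_ : NonZero n}} → p ∣ n →
         mult p n ≡ suc (mult p (n / p))
mult-∣ p 1<p (suc n) p∣n with p ∣? suc n
... | yes _   = cong suc (multAux-fuel p 1<p n (suc n / p) (suc n / p)
                                       (s≤s⁻¹ (m/n<m (suc n) p 1<p)) ≤-refl)
... | no p∤n = contradiction p∣n p∤n

mult-∤ : ∀ p .{{_ : NonZero p}} n → ¬ p ∣ n → mult p n ≡ 0
mult-∤ p zero    p∤n = refl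
mult-∤ p (suc n) p∤n with p ∣? suc n
... | yes p∣n = contradiction p∣n p∤n
... | no _    = refl

mult-< : ∀ p .{{_ : NonZero p}} n .{{_ : NonZero n}} → n < p → mult p n ≡ 0
mult-< p n n<p = mult-∤ p n (λ p∣n → <⇒≱ n<p (∣⇒≤ p∣n))

mult-*-self : ∀ p .{{_ : NonZero p}} → 1 < p → ∀ k .{{_ : NonZero k}} →
              mult p (k * p) ≡ suc (mult p k)
mult-*-self p 1<p k = begin
  mult p (k * p)              ≡⟨ mult-∣ p 1<p (k * p) (n∣m*n k) ⟩
  suc (mult p (k * p / p))    ≡⟨ cong (suc ∘ mult p) (m*n/n≡m k p) ⟩
  suc (mult p k)              ∎
  where instance
          kp≢0 : NonZero (k * p)
          kp≢0 = m*n≢0 k p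

mult-*-coprime : ∀ {p} .{{_ : NonZero p}} → Prime p → ∀ a → ¬ p ∣ a →
                 ∀ b .{{_ : NonZero b}} → mult p (a * b) ≡ mult p b
mult-*-coprime {p} pp a p∤a b = go b (<-wellFounded b)
  where
  1<p : 1 < p
  1<p = nonTrivial⇒n>1 p {{prime⇒nonTrivial pp}}

  instance
    a≢0 : NonZero a
    a≢0 = ≢-nonZero λ { refl → p∤a (p ∣0) }

  go : ∀ b .{{_ : NonZero b}} → Acc _<_ b → mult p (a * b) ≡ mult p b
  go b (acc rec) with p ∣? b
  ... | yes (divides k refl) = begin
    mult p (a * (k * p))    ≡⟨ cong (mult p) (*-assoc a k p) ⟨
    mult p (a * k * p)      ≡⟨ mult-*-self p 1<p (a * k) ⟩
    suc (mult p (a * k))    ≡⟨ cong suc (go k (rec (m<m*n k p 1<p))) ⟩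
    suc (mult p k)          ≡⟨ mult-*-self p 1<p k ⟨
    mult p (k * p)          ∎
    where instance
            k≢0 : NonZero k
            k≢0 = m*n≢0⇒m≢0 k
            ak≢0 : NonZero (a * k)
            ak≢0 = m*n≢0 a k
  ... | no p∤b = trans (mult-∤ p (a * b) p∤ab) (sym (mult-∤ p b p∤b))
    where p∤ab : ¬ p ∣ a * b
          p∤ab p∣ab = [ p∤a , p∤b ]′ (euclidsLemma a b pp p∣ab)

mult-* : ∀ {p} .{{_ : NonZero p}} → Prime p → ∀ a b .{{_ : NonZero a}} .{{_ : NonZero b}} →
         mult p (a * b) ≡ mult p a + mult p b
mult-* {p} pp a b = go a (<-wellFounded a)
  where
  1<p : 1 < p
  1<p = nonTrivial⇒n>1 p {{prime⇒nonTrivial pp}}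

  go : ∀ a .{{_ : NonZero a}} → Acc _<_ a → mult p (a * b) ≡ mult p a + mult p b
  go a (acc rec) with p ∣? a
  ... | yes (divides k refl) = begin
    mult p (k * p * b)            ≡⟨ cong (mult p) (xy∙z≈xz∙y k p b) ⟩
    mult p (k * b * p)            ≡⟨ mult-*-self p 1<p (k * b) ⟩
    suc (mult p (k * b))          ≡⟨ cong suc (go k (rec (m<m*n k p 1<p))) ⟩
    suc (mult p k + mult p b)     ≡⟨ cong (_+ mult p b) (mult-*-self p 1<p k) ⟨
    mult p (k * p) + mult p b     ∎
    where instance
            k≢0 : NonZero k
            k≢0 = m*n≢0⇒m≢0 k
            kb≢0 : NonZero (k * b)
            kb≢0 = m*n≢0 k b
  ... | no p∤a = begin
    mult p (a * b)            ≡⟨ mult-*-coprime pp a p∤a b ⟩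
    mult p b                  ≡⟨ cong (_+ mult p b) (mult-∤ p a p∤a) ⟨
    mult p a + mult p b       ∎

term-cong : ∀ n m d → (Prime (suc (suc d)) → mult (suc (suc d)) n ≡ mult (suc (suc d)) m) →
            term n d ≡ term m d
term-cong n m d eq with prime? (suc (suc d))
... | yes pp = cong (vpp (suc (suc d))) (eq pp)
... | no _   = refl

term-vanishes : ∀ n .{{_ : NonZero n}} d → n ≤ d → term n d ≡ 0
term-vanishes n d n≤d with prime? (suc (suc d))
... | yes _ = cong (vpp (suc (suc d))) (mult-< (suc (suc d)) n (s≤s (m≤n⇒m≤1+n n≤d)))
... | no _  = refl

sum-applyUpTo-zero : ∀ f → (∀ d → f d ≡ 0) → ∀ n → sum (applyUpTo f n) ≡ 0
sum-applyUpTo-zero f f≡0 zero    = refl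
sum-applyUpTo-zero f f≡0 (suc n) = cong₂ _+_ (f≡0 0) (sum-applyUpTo-zero (f ∘ suc) (f≡0 ∘ suc) n)

sum-applyUpTo-vanishing : ∀ f m n → (∀ d → m ≤ d → f d ≡ 0) → m ≤ n →
                          sum (applyUpTo f m) ≡ sum (applyUpTo f n)
sum-applyUpTo-vanishing f zero    n       f≡0 _         = sym (sum-applyUpTo-zero f (λ d → f≡0 d z≤n) n)
sum-applyUpTo-vanishing f (suc m) (suc n) f≡0 (s≤s m≤n) =
  cong (f 0 +_) (sum-applyUpTo-vanishing (f ∘ suc) m n (λ d → f≡0 (suc d) ∘ s≤s) m≤n)

sum-applyUpTo-cong : ∀ f g → (∀ d → f d ≡ g d) → ∀ n → sum (applyUpTo f n) ≡ sum (applyUpTo g n)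
sum-applyUpTo-cong f g f≡g zero    = refl
sum-applyUpTo-cong f g f≡g (suc n) = cong₂ _+_ (f≡g 0) (sum-applyUpTo-cong (f ∘ suc) (g ∘ suc) (f≡g ∘ suc) n)

v-padded : ∀ n .{{_ : NonZero n}} N → n ≤ N → v n ≡ sum (applyUpTo (term n) N)
v-padded n N n≤N = trans (cong sum (map-upTo (term n) n))
                         (sum-applyUpTo-vanishing (term n) n N (term-vanishes n) n≤N)

v-cong : ∀ n m .{{_ : NonZero n}} .{{_ : NonZero m}} →
         (∀ p .{{_ : NonZero p}} → Prime p → 3 < p → mult p n ≡ mult p m) →
         vpp 2 (mult 2 n) + vpp 3 (mult 3 n) ≡ vpp 2 (mult 2 m) + vpp 3 (mult 3 m) →
         v n ≡ v m
-- term x 0 and term x 1 compute to vpp 2 (mult 2 x) and vpp 3 (mult 3 x).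
v-cong n m same-above-3 same-at-2-3 = begin
  v n                                      ≡⟨ v-padded n (2 + K) n≤2+K ⟩
  term n 0 + (term n 1 + high n)           ≡⟨ +-assoc (term n 0) _ _ ⟨
  term n 0 + term n 1 + high n             ≡⟨ cong₂ _+_ same-at-2-3 high-cong ⟩
  term m 0 + term m 1 + high m             ≡⟨ +-assoc (term m 0) _ _ ⟩
  term m 0 + (term m 1 + high m)           ≡⟨ v-padded m (2 + K) m≤2+K ⟨
  v m                                      ∎
  where
  K = n + m

  high : ℕ → ℕ
  high x = sum (applyUpTo (term x ∘ suc ∘ suc) K)

  high-cong : high n ≡ high m
  high-cong = sum-applyUpTo-cong _ _ (λ d → term-cong n m (suc (suc d))
                                        (λ pp → same-above-3 (4 + d) pp (<ᵇ⇒< 3 (4 + d) tt))) K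

  n≤2+K : n ≤ 2 + K
  n≤2+K = ≤-trans (m≤m+n n m) (m≤n+m K 2)

  m≤2+K : m ≤ 2 + K
  m≤2+K = ≤-trans (m≤n+m m n) (m≤n+m K 2)

v[18*R]≡v[81*R] : ∀ R .{{_ : NonZero R}} → ¬ 2 ∣ R → v (18 * R) ≡ v (81 * R)
v[18*R]≡v[81*R] R 2∤R = v-cong (18 * R) (81 * R) same-above-3 same-at-2-3
  where
  instance
    18R≢0 : NonZero (18 * R)
    18R≢0 = m*n≢0 18 R
    81R≢0 : NonZero (81 * R)
    81R≢0 = m*n≢0 81 R

  same-above-3 : ∀ p .{{_ : NonZero p}} → Prime p → 3 < p → mult p (18 * R) ≡ mult p (81 * R)
  same-above-3 p pp 3<p = begin
    mult p (18 * R)        ≡⟨ mult-* pp 18 R ⟩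
    mult p 18 + mult p R   ≡⟨ cong (_+ mult p R) (trans mult[18] (sym mult[81])) ⟩
    mult p 81 + mult p R   ≡⟨ mult-* pp 81 R ⟨
    mult p (81 * R)        ∎
    where
    mult[9] : mult p 9 ≡ 0
    mult[9] = trans (mult-* pp 3 3) (cong₂ _+_ (mult-< p 3 3<p) (mult-< p 3 3<p))
    mult[18] : mult p 18 ≡ 0
    mult[18] = trans (mult-* pp 2 9) (cong₂ _+_ (mult-< p 2 (<-trans (n<1+n 2) 3<p)) mult[9])
    mult[81] : mult p 81 ≡ 0
    mult[81] = trans (mult-* pp 9 9) (cong₂ _+_ mult[9] mult[9])

  same-at-2-3 : vpp 2 (mult 2 (18 * R)) + vpp 3 (mult 3 (18 * R))
              ≡ vpp 2 (mult 2 (81 * R)) + vpp 3 (mult 3 (81 * R))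
  same-at-2-3 = begin
    vpp 2 (mult 2 (18 * R)) + vpp 3 (mult 3 (18 * R))
      ≡⟨ cong₂ (λ i j → vpp 2 i + vpp 3 j) (mult-* prime[2] 18 R) (mult-* prime[3] 18 R) ⟩
    vpp 2 (1 + mult 2 R) + vpp 3 (2 + mult 3 R)
      ≡⟨ cong (λ i → vpp 2 (1 + i) + vpp 3 (2 + mult 3 R)) (mult-∤ 2 R 2∤R) ⟩
    vpp 2 1 + vpp 3 (2 + mult 3 R)
      ≡⟨⟩
    vpp 2 0 + vpp 3 (4 + mult 3 R)
      ≡⟨ cong (λ i → vpp 2 i + vpp 3 (4 + mult 3 R)) (mult-∤ 2 R 2∤R) ⟨
    vpp 2 (0 + mult 2 R) + vpp 3 (4 + mult 3 R)
      ≡⟨ cong₂ (λ i j → vpp 2 i + vpp 3 j) (mult-* prime[2] 81 R) (mult-* prime[3] 81 R) ⟨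
    vpp 2 (mult 2 (81 * R)) + vpp 3 (mult 3 (81 * R))
      ∎

rep[1+k]≡100^k+rep[k] : ∀ k → rep (suc k) ≡ 100 ^ k + rep k
rep[1+k]≡100^k+rep[k] zero    = refl
rep[1+k]≡100^k+rep[k] (suc k) = begin
  1 + 100 * rep (suc k)               ≡⟨ cong (λ x → 1 + 100 * x) (rep[1+k]≡100^k+rep[k] k) ⟩
  1 + 100 * (100 ^ k + rep k)         ≡⟨ distrib (100 ^ k) (rep k) ⟩
  100 * 100 ^ k + (1 + 100 * rep k)   ∎
  where distrib : ∀ a b → 1 + 100 * (a + b) ≡ 100 * a + (1 + 100 * b)
        distrib = solve-∀

n≤rep[n] : ∀ n → n ≤ rep n
n≤rep[n] zero    = z≤n
n≤rep[n] (suc n) = s≤s (≤-trans (n≤rep[n] n) (m≤n*m (rep n) 100))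

18*[1+100*x]-digits : ∀ x → 18 * (1 + 100 * x) ≡ 8 + (1 + 18 * x * 10) * 10
18*[1+100*x]-digits = solve-∀

¬2∣1+100*x : ∀ x → ¬ 2 ∣ 1 + 100 * x
¬2∣1+100*x x = subst (λ n → ¬ 2 ∣ n) (halve x) (¬∣-remainder 1 (50 * x) z<s (<ᵇ⇒< 1 2 tt))
  where halve : ∀ x → 1 + 50 * x * 2 ≡ 1 + 100 * x
        halve = solve-∀

revAux-digit : ∀ f d q rev → suc d < 10 →
               revAux (suc f) (suc d + q * 10) rev ≡ revAux f q (rev * 10 + suc d)
revAux-digit f d q rev d<10 = cong₂ (revAux f) next-digits next-rev
  where
  next-digits : (suc d + q * 10) / 10 ≡ q
  next-digits = begin
    (suc d + q * 10) / 10       ≡⟨ +-distrib-/-∣ʳ (suc d) (divides q refl) ⟩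
    suc d / 10 + q * 10 / 10    ≡⟨ cong₂ _+_ (m<n⇒m/n≡0 d<10) (m*n/n≡m q 10) ⟩
    q                           ∎
  next-rev : rev * 10 + (suc d + q * 10) % 10 ≡ rev * 10 + suc d
  next-rev = cong (rev * 10 +_) (trans ([m+kn]%n≡m%n (suc d) q 10) (m<n⇒m%n≡m d<10))

-- The fuel bound is written k * 2 because suc k * 2 unfolds to 2 + k * 2.
revAux-18*rep : ∀ k f rev → k * 2 ≤ f → revAux f (18 * rep k) rev ≡ rev * 100 ^ k + 81 * rep k
revAux-18*rep zero    zero          rev _ = sym (trans (+-identityʳ _) (*-identityʳ rev))
revAux-18*rep zero    (suc f)       rev _ = sym (trans (+-identityʳ _) (*-identityʳ rev))
revAux-18*rep (suc k) (suc (suc f)) rev (s≤s (s≤s 2k≤f)) = begin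
  revAux (2 + f) (18 * rep (suc k)) rev
    ≡⟨ cong (λ n → revAux (2 + f) n rev) (18*[1+100*x]-digits (rep k)) ⟩
  revAux (2 + f) (8 + (1 + 18 * rep k * 10) * 10) rev
    ≡⟨ revAux-digit (suc f) 7 (1 + 18 * rep k * 10) rev (<ᵇ⇒< 8 10 tt) ⟩
  revAux (1 + f) (1 + 18 * rep k * 10) (rev * 10 + 8)
    ≡⟨ revAux-digit f 0 (18 * rep k) (rev * 10 + 8) (<ᵇ⇒< 1 10 tt) ⟩
  revAux f (18 * rep k) ((rev * 10 + 8) * 10 + 1)
    ≡⟨ revAux-18*rep k f _ 2k≤f ⟩
  ((rev * 10 + 8) * 10 + 1) * 100 ^ k + 81 * rep k
    ≡⟨ regroup rev (100 ^ k) (rep k) ⟩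
  rev * (100 * 100 ^ k) + 81 * (100 ^ k + rep k)
    ≡⟨ cong (λ x → rev * 100 ^ suc k + 81 * x) (rep[1+k]≡100^k+rep[k] k) ⟨
  rev * 100 ^ suc k + 81 * rep (suc k)
    ∎
  where regroup : ∀ a P x → ((a * 10 + 8) * 10 + 1) * P + 81 * x ≡ a * (100 * P) + 81 * (P + x)
        regroup = solve-∀

r[18*rep]≡81*rep : ∀ k → r (18 * rep k) ≡ 81 * rep k
r[18*rep]≡81*rep k = revAux-18*rep k (18 * rep k) 0
  (≤-trans (*-mono-≤ (n≤rep[n] k) (s≤s (s≤s z≤n))) (≤-reflexive (*-comm (rep k) 18)))

corollary5p2 : (k : ℕ) → 1 ≤ k → VPalindrome (18 * rep k)
corollary5p2 (suc k) _ = record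
  { positive = s≤s z≤n
  ; not10∣   = subst (λ n → ¬ 10 ∣ n) (sym (18*[1+100*x]-digits (rep k)))
                     (¬∣-remainder 8 (1 + 18 * rep k * 10) z<s (<ᵇ⇒< 8 10 tt))
  ; notPalin = λ n≡r[n] → 18≢81 (*-cancelʳ-≡ 18 81 R (trans n≡r[n] (r[18*rep]≡81*rep (suc k))))
  ; vEq      = trans (v[18*R]≡v[81*R] R (¬2∣1+100*x (rep k))) (cong v (sym (r[18*rep]≡81*rep (suc k))))
  }
  where
  R : ℕ
  R = rep (suc k)

  18≢81 : 18 ≢ 81
  18≢81 ()
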